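{- Let $D,D',E,E'$ be ASDs. (i) If $D\le D'$ and $E\le E'$, then $D\times E\le D'\times E'$. (ii) If $D\le D'$, then $D^{(k)}\le D'^{(k)}$ for every integer $k\ge1$.
   Context: An ASD is a pair $D=(\mathcal{S}_D,\mathcal{P}_D)$ with $\mathcal{S}_D$ a finite set and $\mathcal{P}_D$ a finite family of set partitions of $\mathcal{S}_D$. For partitions, $\pi\preceq\pi'$ means every block of $\pi$ lies in a block of $\pi'$, and $\wedge$ is the meet (partition into nonempty intersections of blocks). For $\phi:\mathcal{S}\to\mathcal{S}'$ and a partition $\pi$ of $\mathcal{S}'$, $\pi\circ\phi$ is the partition of $\mathcal{S}$ where $x,y$ share a block iff $\phi(x),\phi(y)$ share a block of $\pi$. $D\le D'$ means there exist $\phi:\mathcal{S}_D\to\mathcal{S}_{D'}$, $\alpha:\mathcal{P}_D\to\mathcal{P}_{D'}$ with $\alpha(\pi)\circ\phi\preceq\pi$ for all $\pi\in\mathcal{P}_D$. The direct product $D\times D'$ has state space $\mathcal{S}_D\times\mathcal{S}_{D'}$ and partition set $\{\pi\times\pi'\}$ with $\pi\times\pi'=\{B\times B':B\in\pi,B'\in\pi'\}$. For $k\ge1$, $D^{(k)}$ has state space $\mathcal{S}_D$ and partition set $\{\pi_1\wedge\cdots\wedge\pi_k:\pi_1,\dots,\pi_k\in\mathcal{P}_D\}$. -}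

module Defs where

open import Level using (0ℓ)
open import Data.Nat using (ℕ; zero; suc; _*_)
open import Data.Fin using (Fin)
open import Data.Fin.Properties using (*↔×; 1↔⊤)
open import Data.Product using (Σ; _×_; _,_; proj₁; proj₂)
open import Data.Product.Function.NonDependent.Propositional using (_×-↔_)
open import Data.Unit using (⊤; tt)
open import Data.Vec using (Vec; []; _∷_)
open import Function.Bundles using (_↔_; mk↔ₛ′)
open import Function.Properties.Inverse using (↔-trans; ↔-sym)
open import Relation.Binary.PropositionalEquality using (_≡_; refl; cong₂)

Finite : Set → Set
Finite A = Σ ℕ λ n → Fin n ↔ A

-- A partition is presented by a block-labelling map  label : S → Label ;
-- the blocks of the partition are exactly the NONEMPTY fibres of label.
-- Every set partition arises this way (label x = the block of x), and two
-- labellings describe the same partition iff they have the same kernel.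
-- All notions below only depend on the kernel ("x and y share a block").

record Partition (S : Set) : Set₁ where
  constructor mkPartition
  field
    Label : Set
    label : S → Label

open Partition public

SameBlock : {S : Set} → Partition S → S → S → Set
SameBlock π x y = label π x ≡ label π y

_≼_ : {S : Set} → Partition S → Partition S → Set
π ≼ π' = ∀ x y → SameBlock π x y → SameBlock π' x y

_∘ₚ_ : {S S' : Set} → Partition S' → (S → S') → Partition S
π ∘ₚ φ = mkPartition (Label π) (λ x → label π (φ x))

_∧ₚ_ : {S : Set} → Partition S → Partition S → Partition S
π ∧ₚ π' = mkPartition (Label π × Label π') (λ x → label π x , label π' x)

_×ₚ_ : {S S' : Set} → Partition S → Partition S' → Partition (S × S')
π ×ₚ π' = mkPartition (Label π × Label π') (λ p → label π (proj₁ p) , label π' (proj₂ p))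

-- The family is given as an indexed family  part : Index → Partition State
-- with Index finite (repetitions are harmless for everything below).

record ASD : Set₁ where
  field
    State       : Set
    stateFinite : Finite State
    Index       : Set
    indexFinite : Finite Index
    part        : Index → Partition State

open ASD public

_≤ᴬ_ : ASD → ASD → Set
D ≤ᴬ D' = Σ (State D → State D') λ φ →
          Σ (Index D → Index D') λ α →
          ∀ i → (part D' (α i) ∘ₚ φ) ≼ part D i

×-finite : {A B : Set} → Finite A → Finite B → Finite (A × B)
×-finite (m , f) (n , g) = m * n , ↔-trans *↔× (f ×-↔ g)

Vec⊤↔ : {A : Set} → Vec A 0 ↔ ⊤
Vec⊤↔ = mk↔ₛ′ (λ _ → tt) (λ _ → []) (λ { tt → refl }) (λ { [] → refl })

Vec∷↔ : {A : Set} {k : ℕ} → (A × Vec A k) ↔ Vec A (suc k)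
Vec∷↔ = mk↔ₛ′ (λ { (a , v) → a ∷ v }) (λ { (a ∷ v) → a , v })
              (λ { (a ∷ v) → refl }) (λ { (a , v) → refl })

Vec-finite : {A : Set} (k : ℕ) → Finite A → Finite (Vec A k)
Vec-finite zero    fA = 1 , ↔-trans 1↔⊤ (↔-sym Vec⊤↔)
Vec-finite (suc k) fA = let (n , h) = ×-finite fA (Vec-finite k fA)
                        in n , ↔-trans h Vec∷↔

_×ᴬ_ : ASD → ASD → ASD
D ×ᴬ D' = record
  { State       = State D × State D'
  ; stateFinite = ×-finite (stateFinite D) (stateFinite D')
  ; Index       = Index D × Index D'
  ; indexFinite = ×-finite (indexFinite D) (indexFinite D')
  ; part        = λ p → part D (proj₁ p) ×ₚ part D' (proj₂ p)
  }

meetVec : {S I : Set} → (I → Partition S) → {n : ℕ} → Vec I (suc n) → Partition S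
meetVec P (i ∷ [])     = P i
meetVec P (i ∷ j ∷ is) = P i ∧ₚ meetVec P (j ∷ is)

-- power D n  is  D^(suc n)
power : ASD → ℕ → ASD
power D n = record
  { State       = State D
  ; stateFinite = stateFinite D
  ; Index       = Vec (Index D) (suc n)
  ; indexFinite = Vec-finite (suc n) (indexFinite D)
  ; part        = meetVec (part D)
  }

open import Data.Nat using (_≤_; s≤s)
_^⟨_⟩ : ASD → (k : ℕ) → {1 ≤ k} → ASD
(D ^⟨ suc n ⟩) {s≤s _} = power D n

module Submission where

-- Both constructions are built from two operations on
-- partitions, the product ×ₚ and the meet ∧ₚ, so the proof reduces to two
-- facts saying that these operations preserve the relation "σ ∘ φ ≼ π":
--   * pullback-×ₚ : it passes to products of partitions along φ × ψ;
--   * pullback-∧ₚ : it passes to meets along a single φ,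
-- and, by induction on the length of the tuple, to iterated meets
-- (pullback-meetVec).  Part (i) then uses the witness (φ × ψ, α × β) and
-- part (ii) the witness (φ, α applied componentwise to k-tuples).

open import Defs
open import Data.Nat using (ℕ; _≤_; suc; s≤s)
open import Data.Product using (_×_; _,_; proj₁; proj₂)
  renaming (map to map-×)
open import Data.Product.Properties using (,-injectiveˡ; ,-injectiveʳ)
open import Data.Vec using (Vec; []; _∷_) renaming (map to map-Vec)
open import Relation.Binary.PropositionalEquality using (cong₂)

pullback-×ₚ : {S S' T T' : Set} {φ : S → T} {ψ : S' → T'}
  (σ : Partition T) (σ' : Partition T') (π : Partition S) (π' : Partition S') →
  (σ ∘ₚ φ) ≼ π → (σ' ∘ₚ ψ) ≼ π' →
  ((σ ×ₚ σ') ∘ₚ map-× φ ψ) ≼ (π ×ₚ π')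
pullback-×ₚ σ σ' π π' r r' (x , x') (y , y') same =
  cong₂ _,_ (r x y (,-injectiveˡ same)) (r' x' y' (,-injectiveʳ same))

pullback-∧ₚ : {S T : Set} {φ : S → T}
  (σ σ' : Partition T) (π π' : Partition S) →
  (σ ∘ₚ φ) ≼ π → (σ' ∘ₚ φ) ≼ π' →
  ((σ ∧ₚ σ') ∘ₚ φ) ≼ (π ∧ₚ π')
pullback-∧ₚ σ σ' π π' r r' x y same =
  cong₂ _,_ (r x y (,-injectiveˡ same)) (r' x y (,-injectiveʳ same))

pullback-meetVec : {S T I J : Set} {φ : S → T}
  (P : I → Partition S) (Q : J → Partition T) (α : I → J) →
  (∀ i → (Q (α i) ∘ₚ φ) ≼ P i) →
  {n : ℕ} (is : Vec I (suc n)) →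
  (meetVec Q (map-Vec α is) ∘ₚ φ) ≼ meetVec P is
pullback-meetVec P Q α r (i ∷ [])     = r i
pullback-meetVec P Q α r (i ∷ j ∷ is) =
  pullback-∧ₚ (Q (α i)) (meetVec Q (map-Vec α (j ∷ is)))
              (P i) (meetVec P (j ∷ is))
              (r i) (pullback-meetVec P Q α r (j ∷ is))

×ᴬ-mono : (D D' E E' : ASD) → D ≤ᴬ D' → E ≤ᴬ E' → (D ×ᴬ E) ≤ᴬ (D' ×ᴬ E')
×ᴬ-mono D D' E E' (φ , α , r) (ψ , β , s) =
  map-× φ ψ , map-× α β ,
  λ { (i , j) → pullback-×ₚ (part D' (α i)) (part E' (β j))
                            (part D i) (part E j) (r i) (s j) }

power-mono : (D D' : ASD) → D ≤ᴬ D' → (n : ℕ) → power D n ≤ᴬ power D' n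
power-mono D D' (φ , α , r) n =
  φ , map-Vec α , pullback-meetVec (part D) (part D') α r

proposition1 : (D D' E E' : ASD) →
    ((D ≤ᴬ D') → (E ≤ᴬ E') → ((D ×ᴬ E) ≤ᴬ (D' ×ᴬ E')))
    × ((D ≤ᴬ D') → (k : ℕ) → (hk : 1 ≤ k) → ((D ^⟨ k ⟩) {hk} ≤ᴬ (D' ^⟨ k ⟩) {hk}))
proposition1 D D' E E' = ×ᴬ-mono D D' E E' , powers
  where
  powers : D ≤ᴬ D' → (k : ℕ) → (hk : 1 ≤ k) → (D ^⟨ k ⟩) {hk} ≤ᴬ (D' ^⟨ k ⟩) {hk}
  powers D≤D' (suc n) (s≤s _) = power-mono D D' D≤D' n
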